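{- Let $p$ be a prime and $r\geq 2$ an integer, and suppose $k>1$ is an integer such that $r$ divides $S=\sum_{i=1}^{kr}p^{kr-i}$. Then for every integer $h$ with $1\leq h<k$, the integer $\frac{S}{r}-h$ does not lie in the image of $Z_{p^r}:\mathbb{N}\to\mathbb{N}$.
   Context: For an integer $b\geq 2$, $Z_b(m)$ denotes the number of trailing zeroes in the base $b$ expansion of $m!$. In particular $Z_{p^r}(m)=\lfloor Z_p(m)/r\rfloor$ where $Z_p(m)$ is the exponent of $p$ in $m!$. -}

module Defs where

open import Data.Nat using (ℕ; zero; suc; _+_; _*_; _∸_; _^_; _!)
open import Data.Nat.Divisibility using (_∣?_)
open import Data.Nat.DivMod using (_/_)
open import Relation.Nullary.Decidable using (yes; no)

sum1 : ℕ → (ℕ → ℕ) → ℕ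
sum1 zero    f = zero
sum1 (suc n) f = sum1 n f + f (suc n)

-- mult b fuel n : number of times b divides n (repeatedly dividing),
-- with at most 'fuel' steps.  For n ≥ 1 and b ≥ 2, fuel = n suffices,
-- since b^e ∣ n implies e < n.
mult : (b : ℕ) → ℕ → ℕ → ℕ
mult b zero       n = zero
mult zero (suc f) n = zero
mult (suc b) (suc f) n with suc b ∣? n
... | yes _ = suc (mult (suc b) f (n / suc b))
... | no  _ = zero

-- Z b m : number of trailing zeroes of the base-b expansion of m!,
-- i.e. the largest e with b^e ∣ m!  (meaningful for b ≥ 2; m! ≥ 1).
Z : ℕ → ℕ → ℕ
Z b m = mult b (m !) (m !)

{-# OPTIONS --safe #-}

-- Write a = k r and S = 1 + p + ⋯ + p^(a-1) = r q.  By Legendre's formula v_p((p^a)!) = S,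
-- and since (p^a)! = p^a (p^a - 1)!, also v_p((p^a - 1)!) = S - a = r (q - k).  Hence
-- v_p(m!) ≥ r q when m ≥ p^a and v_p(m!) ≤ r (q - k) when m < p^a.  As
-- Z_{p^r}(m) = ⌊v_p(m!) / r⌋, the value Z_{p^r}(m) is either ≥ q or ≤ q - k, so it
-- never equals q - h for 0 < h < k.
module Submission where

open import Defs
open import Data.Nat
  using (ℕ; zero; suc; _+_; _*_; _∸_; _^_; _≤_; _<_; _!; z≤n; s≤s; _≤?_; pred;
         NonZero; ≢-nonZero; ≢-nonZero⁻¹; >-nonZero; >-nonZero⁻¹; nonTrivial⇒n>1)
open import Data.Nat.Properties
open import Algebra.Properties.CommutativeSemigroup +-commutativeSemigroup using (x∙yz≈y∙xz)
open import Data.Nat.Divisibility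
open import Data.Nat.DivMod using (_/_; m*[n/m]≡n)
open import Data.Nat.Primality using (Prime; euclidsLemma; prime⇒nonZero; prime⇒nonTrivial)
open import Data.Product using (∃; _×_; _,_)
open import Data.Sum using (_⊎_; inj₁; inj₂; [_,_]′)
open import Function using (_∘_)
open import Relation.Binary.PropositionalEquality
open import Relation.Nullary using (¬_; yes; no; contradiction)

sum1-suc : ∀ n f → sum1 (suc n) f ≡ f 1 + sum1 n (f ∘ suc)
sum1-suc zero    f = sym (+-identityʳ (f 1))
sum1-suc (suc n) f = trans (cong (_+ f (suc (suc n))) (sum1-suc n f))
                           (+-assoc (f 1) (sum1 n (f ∘ suc)) (f (suc (suc n))))

repunit : ℕ → ℕ → ℕ
repunit b a = sum1 a (λ i → b ^ (a ∸ i))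

repunit-suc : ∀ b a → repunit b (suc a) ≡ b ^ a + repunit b a
repunit-suc b a = sum1-suc a (λ i → b ^ (suc a ∸ i))

a≤repunit : ∀ b .{{_ : NonZero b}} a → a ≤ repunit b a
a≤repunit b zero    = z≤n
a≤repunit b (suc a) = subst (suc a ≤_) (sym (repunit-suc b a)) (+-mono-≤ (m^n>0 b a) (a≤repunit b a))

n<m^n : ∀ {m} n → 1 < m → n < m ^ n
n<m^n zero    _   = s≤s z≤n
n<m^n (suc n) 1<m = ≤-<-trans (n<m^n n 1<m) (^-monoʳ-< _ 1<m (n<1+n n))

^-monoʳ-∣ : ∀ m {i j} → i ≤ j → m ^ i ∣ m ^ j
^-monoʳ-∣ m {i} i≤j with m≤n⇒∃[o]m+o≡n i≤j
... | o , refl = divides (m ^ o) (trans (^-distribˡ-+-* m i o) (*-comm (m ^ i) (m ^ o)))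

n!≡n*[n∸1]! : ∀ n .{{_ : NonZero n}} → n ! ≡ n * (n ∸ 1) !
n!≡n*[n∸1]! (suc n) = refl

mult-∣ : ∀ b f n → b ^ mult b f n ∣ n
mult-∣ b       zero    n = 1∣ n
mult-∣ zero    (suc f) n = 1∣ n
mult-∣ (suc b) (suc f) n with suc b ∣? n
... | yes b∣n = subst (suc b ^ suc (mult (suc b) f (n / suc b)) ∣_) (m*[n/m]≡n b∣n)
                  (*-monoʳ-∣ (suc b) (mult-∣ (suc b) f (n / suc b)))
... | no  _   = 1∣ n

mult-maximal : ∀ b f n e .{{_ : NonZero n}} → e ≤ f → suc b ^ e ∣ n → e ≤ mult (suc b) f n
mult-maximal b f       n zero    _         _       = z≤n
mult-maximal b (suc f) n (suc e) (s≤s e≤f) bᵉ⁺¹∣n with suc b ∣? n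
... | no  b∤n = contradiction (∣-trans (m∣m*n (suc b ^ e)) bᵉ⁺¹∣n) b∤n
... | yes b∣n = s≤s (mult-maximal b f (n / suc b) e {{n/b≢0}} e≤f bᵉ∣n/b)
  where
  b*[n/b]≡n : suc b * (n / suc b) ≡ n
  b*[n/b]≡n = m*[n/m]≡n b∣n

  n/b≢0 : NonZero (n / suc b)
  n/b≢0 = ≢-nonZero λ n/b≡0 →
    ≢-nonZero⁻¹ n (trans (sym b*[n/b]≡n) (trans (cong (suc b *_) n/b≡0) (*-zeroʳ (suc b))))

  bᵉ∣n/b : suc b ^ e ∣ n / suc b
  bᵉ∣n/b = *-cancelˡ-∣ (suc b) (subst (suc b ^ suc e ∣_) (sym b*[n/b]≡n) bᵉ⁺¹∣n)

ν : ℕ → ℕ → ℕ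
ν b n = mult b n n

ν-∣ : ∀ b n → b ^ ν b n ∣ n
ν-∣ b n = mult-∣ b n n

ν-maximal : ∀ {b n e} .{{_ : NonZero n}} → 1 < b → b ^ e ∣ n → e ≤ ν b n
ν-maximal {suc b} {n} {e} 1<b bᵉ∣n =
  mult-maximal b n n e (<⇒≤ (<-≤-trans (n<m^n e 1<b) (∣⇒≤ bᵉ∣n))) bᵉ∣n

ν-mono-∣ : ∀ {b m n} .{{_ : NonZero n}} → 1 < b → m ∣ n → ν b m ≤ ν b n
ν-mono-∣ {b} {m} 1<b m∣n = ν-maximal 1<b (∣-trans (ν-∣ b m) m∣n)

r*ν[bʳ]≤ν[b] : ∀ b r n .{{_ : NonZero n}} → 1 < b → r * ν (b ^ r) n ≤ ν b n
r*ν[bʳ]≤ν[b] b r n 1<b =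
  ν-maximal 1<b (subst (_∣ n) (^-*-assoc b r (ν (b ^ r) n)) (ν-∣ (b ^ r) n))

ν[b]<r*suc[ν[bʳ]] : ∀ b r n .{{_ : NonZero n}} .{{_ : NonZero r}} →
                    1 < b → ν b n < r * suc (ν (b ^ r) n)
ν[b]<r*suc[ν[bʳ]] b r n 1<b = ≰⇒> λ r*[z+1]≤ν → 1+n≰n (ν-maximal 1<bʳ (bʳ⁽ᶻ⁺¹⁾∣n r*[z+1]≤ν))
  where
  z : ℕ
  z = ν (b ^ r) n

  1<bʳ : 1 < b ^ r
  1<bʳ = ^-monoʳ-< b 1<b (>-nonZero⁻¹ r)

  bʳ⁽ᶻ⁺¹⁾∣n : r * suc z ≤ ν b n → (b ^ r) ^ suc z ∣ n
  bʳ⁽ᶻ⁺¹⁾∣n le = subst (_∣ n) (sym (^-*-assoc b r (suc z))) (∣-trans (^-monoʳ-∣ b le) (ν-∣ b n))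

module _ {p : ℕ} (p-prime : Prime p) where

  private
    instance
      p≢0 : NonZero p
      p≢0 = prime⇒nonZero p-prime

    1<p : 1 < p
    1<p = nonTrivial⇒n>1 p {{prime⇒nonTrivial p-prime}}

    p∤1 : ¬ p ∣ 1
    p∤1 = >⇒∤ 1<p

    ∤⇒≢0 : ∀ {u} → ¬ p ∣ u → NonZero u
    ∤⇒≢0 {zero}  p∤0 = contradiction (p ∣0) p∤0
    ∤⇒≢0 {suc _} _   = _

  ν-cofactor : ∀ n .{{_ : NonZero n}} → ∃ λ u → n ≡ u * p ^ ν p n × ¬ p ∣ u
  ν-cofactor n with ν-∣ p n
  ... | divides u n≡u*pᵛ = u , n≡u*pᵛ , λ p∣u →
    1+n≰n (ν-maximal 1<p (subst (p * p ^ ν p n ∣_) (sym n≡u*pᵛ) (*-monoˡ-∣ (p ^ ν p n) p∣u)))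

  ν-char : ∀ {n u v} → n ≡ u * p ^ v → ¬ p ∣ u → ν p n ≡ v
  ν-char {n} {u} {v} n≡u*pᵛ p∤u = ≤-antisym ν≤v (ν-maximal 1<p (divides u n≡u*pᵛ))
    where
    instance
      n≢0 : NonZero n
      n≢0 = subst NonZero (sym n≡u*pᵛ) (m*n≢0 u (p ^ v) {{∤⇒≢0 p∤u}} {{m^n≢0 p v}})

    ν≤v : ν p n ≤ v
    ν≤v = ≮⇒≥ λ v<ν → p∤u (*-cancelʳ-∣ (p ^ v) {{m^n≢0 p v}}
      (∣-trans (^-monoʳ-∣ p v<ν) (subst (p ^ ν p n ∣_) n≡u*pᵛ (ν-∣ p n))))

  ν-* : ∀ m n .{{_ : NonZero m}} .{{_ : NonZero n}} → ν p (m * n) ≡ ν p m + ν p n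
  ν-* m n with ν-cofactor m | ν-cofactor n
  ... | u , m≡u*pˣ , p∤u | w , n≡w*pʸ , p∤w = ν-char m*n≡uw*pˣ⁺ʸ p∤uw
    where
    open ≡-Reasoning
    m*n≡uw*pˣ⁺ʸ : m * n ≡ (u * w) * p ^ (ν p m + ν p n)
    m*n≡uw*pˣ⁺ʸ = begin
      m * n                                 ≡⟨ cong₂ _*_ m≡u*pˣ n≡w*pʸ ⟩
      (u * p ^ ν p m) * (w * p ^ ν p n)     ≡⟨ [m*n]*[o*p]≡[m*o]*[n*p] u _ w _ ⟩
      (u * w) * (p ^ ν p m * p ^ ν p n)     ≡⟨ cong ((u * w) *_) (^-distribˡ-+-* p (ν p m) (ν p n)) ⟨
      (u * w) * p ^ (ν p m + ν p n)         ∎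

    p∤uw : ¬ p ∣ u * w
    p∤uw p∣uw = [ p∤u , p∤w ]′ (euclidsLemma u w p-prime p∣uw)

  ν[[1+n]!] : ∀ n → ν p (suc n !) ≡ ν p (suc n) + ν p (n !)
  ν[[1+n]!] n = ν-* (suc n) (n !) {{_}} {{n !≢0}}

  ν-∤ : ∀ {u} → ¬ p ∣ u → ν p u ≡ 0
  ν-∤ {u} = ν-char (sym (*-identityʳ u))

  ν[pᵃ]≡a : ∀ a → ν p (p ^ a) ≡ a
  ν[pᵃ]≡a a = ν-char (sym (*-identityˡ (p ^ a))) p∤1

  ν[p*n]≡1+ν[n] : ∀ n .{{_ : NonZero n}} → ν p (p * n) ≡ suc (ν p n)
  ν[p*n]≡1+ν[n] n = trans (ν-* p n) (cong (_+ ν p n) ν[p]≡1)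
    where
    ν[p]≡1 : ν p p ≡ 1
    ν[p]≡1 = trans (cong (ν p) (sym (*-identityʳ p))) (ν[pᵃ]≡a 1)

  ν[[p*n+t]!]≡ν[[p*n]!] : ∀ n t → t < p → ν p ((p * n + t) !) ≡ ν p ((p * n) !)
  ν[[p*n+t]!]≡ν[[p*n]!] n zero    _   = cong (λ x → ν p (x !)) (+-identityʳ (p * n))
  ν[[p*n+t]!]≡ν[[p*n]!] n (suc t) t<p = begin
    ν p ((p * n + suc t) !)                       ≡⟨ cong (λ x → ν p (x !)) (+-suc (p * n) t) ⟩
    ν p (suc (p * n + t) * (p * n + t) !)         ≡⟨ ν[[1+n]!] (p * n + t) ⟩
    ν p (suc (p * n + t)) + ν p ((p * n + t) !)   ≡⟨ cong₂ _+_ (ν-∤ p∤1+p*n+t) (ν[[p*n+t]!]≡ν[[p*n]!] n t (<⇒≤ t<p)) ⟩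
    ν p ((p * n) !)                               ∎
    where
    open ≡-Reasoning
    p∤1+p*n+t : ¬ p ∣ suc (p * n + t)
    p∤1+p*n+t p∣ = >⇒∤ t<p (∣m+n∣m⇒∣n (subst (p ∣_) (sym (+-suc (p * n) t)) p∣) (m∣m*n n))

  ν[[p*n]!]≡n+ν[n!] : ∀ n → ν p ((p * n) !) ≡ n + ν p (n !)
  ν[[p*n]!]≡n+ν[n!] zero    = cong (λ x → ν p (x !)) (*-zeroʳ p)
  ν[[p*n]!]≡n+ν[n!] (suc n) = begin
    ν p ((p * suc n) !)                              ≡⟨ cong (λ x → ν p (x !)) p*[1+n]≡1+m ⟩
    ν p (suc m * m !)                                ≡⟨ ν[[1+n]!] m ⟩
    ν p (suc m) + ν p (m !)                          ≡⟨ cong₂ _+_ (cong (ν p) (sym p*[1+n]≡1+m))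
                                                              (ν[[p*n+t]!]≡ν[[p*n]!] n (pred p) pred[p]<p) ⟩
    ν p (p * suc n) + ν p ((p * n) !)                ≡⟨ cong₂ _+_ (ν[p*n]≡1+ν[n] (suc n)) (ν[[p*n]!]≡n+ν[n!] n) ⟩
    suc (ν p (suc n) + (n + ν p (n !)))              ≡⟨ cong suc (x∙yz≈y∙xz (ν p (suc n)) n (ν p (n !))) ⟩
    suc n + (ν p (suc n) + ν p (n !))                ≡⟨ cong (suc n +_) (ν[[1+n]!] n) ⟨
    suc n + ν p (suc n !)                            ∎
    where
    open ≡-Reasoning
    m : ℕ
    m = p * n + pred p

    pred[p]<p : pred p < p
    pred[p]<p = ≤-reflexive (suc-pred p)

    p*[1+n]≡1+m : p * suc n ≡ suc m
    p*[1+n]≡1+m = begin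
      p * suc n            ≡⟨ *-suc p n ⟩
      p + p * n            ≡⟨ +-comm p (p * n) ⟩
      p * n + p            ≡⟨ cong (p * n +_) (suc-pred p) ⟨
      p * n + suc (pred p) ≡⟨ +-suc (p * n) (pred p) ⟩
      suc m                ∎

  ν[[pᵃ]!]≡repunit : ∀ a → ν p ((p ^ a) !) ≡ repunit p a
  ν[[pᵃ]!]≡repunit zero    = ν-∤ p∤1
  ν[[pᵃ]!]≡repunit (suc a) = begin
    ν p ((p * p ^ a) !)       ≡⟨ ν[[p*n]!]≡n+ν[n!] (p ^ a) ⟩
    p ^ a + ν p ((p ^ a) !)   ≡⟨ cong (p ^ a +_) (ν[[pᵃ]!]≡repunit a) ⟩
    p ^ a + repunit p a       ≡⟨ repunit-suc p a ⟨
    repunit p (suc a)         ∎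
    where open ≡-Reasoning

  a+ν[[pᵃ∸1]!]≡repunit : ∀ a → a + ν p ((p ^ a ∸ 1) !) ≡ repunit p a
  a+ν[[pᵃ∸1]!]≡repunit a = begin
    a + ν p ((p ^ a ∸ 1) !)             ≡⟨ cong (_+ ν p ((p ^ a ∸ 1) !)) (ν[pᵃ]≡a a) ⟨
    ν p (p ^ a) + ν p ((p ^ a ∸ 1) !)   ≡⟨ ν-* (p ^ a) ((p ^ a ∸ 1) !) {{m^n≢0 p a}} {{(p ^ a ∸ 1) !≢0}} ⟨
    ν p (p ^ a * (p ^ a ∸ 1) !)         ≡⟨ cong (ν p) (n!≡n*[n∸1]! (p ^ a) {{m^n≢0 p a}}) ⟨
    ν p ((p ^ a) !)                     ≡⟨ ν[[pᵃ]!]≡repunit a ⟩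
    repunit p a                         ∎
    where open ≡-Reasoning

  q≤Z[pʳ] : ∀ r a q m .{{_ : NonZero r}} → repunit p a ≡ r * q → p ^ a ≤ m → q ≤ Z (p ^ r) m
  q≤Z[pʳ] r a q m S≡r*q pᵃ≤m = ≤-pred (*-cancelˡ-< r q (suc (Z (p ^ r) m)) (begin-strict
    r * q                      ≡⟨ S≡r*q ⟨
    repunit p a                ≡⟨ ν[[pᵃ]!]≡repunit a ⟨
    ν p ((p ^ a) !)            ≤⟨ ν-mono-∣ 1<p (m≤n⇒m!∣n! pᵃ≤m) ⟩
    ν p (m !)                  <⟨ ν[b]<r*suc[ν[bʳ]] p r (m !) 1<p ⟩
    r * suc (Z (p ^ r) m)      ∎))
    where
    open ≤-Reasoning
    instance
      m!≢0 : NonZero (m !)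
      m!≢0 = m !≢0

  Z[pʳ]+k≤q : ∀ r k q m .{{_ : NonZero r}} → repunit p (k * r) ≡ r * q → m < p ^ (k * r) →
              Z (p ^ r) m + k ≤ q
  Z[pʳ]+k≤q r k q m S≡r*q m<pᵃ = *-cancelˡ-≤ r (begin
    r * (z + k)                             ≡⟨ *-distribˡ-+ r z k ⟩
    r * z + r * k                           ≤⟨ +-monoˡ-≤ (r * k) (r*ν[bʳ]≤ν[b] p r (m !) 1<p) ⟩
    ν p (m !) + r * k                       ≤⟨ +-monoˡ-≤ (r * k) (ν-mono-∣ 1<p (m≤n⇒m!∣n! (<⇒≤pred m<pᵃ))) ⟩
    ν p ((p ^ (k * r) ∸ 1) !) + r * k       ≡⟨ +-comm _ (r * k) ⟩
    r * k + ν p ((p ^ (k * r) ∸ 1) !)       ≡⟨ cong (_+ ν p ((p ^ (k * r) ∸ 1) !)) (*-comm r k) ⟩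
    k * r + ν p ((p ^ (k * r) ∸ 1) !)       ≡⟨ a+ν[[pᵃ∸1]!]≡repunit (k * r) ⟩
    repunit p (k * r)                       ≡⟨ S≡r*q ⟩
    r * q                                   ∎)
    where
    open ≤-Reasoning
    instance
      m!≢0 : NonZero (m !)
      m!≢0 = m !≢0
      [pᵃ∸1]!≢0 : NonZero ((p ^ (k * r) ∸ 1) !)
      [pᵃ∸1]!≢0 = (p ^ (k * r) ∸ 1) !≢0

    z : ℕ
    z = Z (p ^ r) m

  Z[pʳ]-gap : ∀ r k q m .{{_ : NonZero r}} → repunit p (k * r) ≡ r * q →
              Z (p ^ r) m + k ≤ q ⊎ q ≤ Z (p ^ r) m
  Z[pʳ]-gap r k q m S≡r*q with p ^ (k * r) ≤? m
  ... | yes pᵃ≤m = inj₂ (q≤Z[pʳ] r (k * r) q m S≡r*q pᵃ≤m)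
  ... | no  pᵃ≰m = inj₁ (Z[pʳ]+k≤q r k q m S≡r*q (≰⇒> pᵃ≰m))

proposition7 : (p r k : ℕ) → Prime p → 2 ≤ r → 1 < k →
    (q : ℕ) → sum1 (k * r) (λ i → p ^ (k * r ∸ i)) ≡ r * q →
    (h : ℕ) → 1 ≤ h → h < k →
    ¬ (∃ λ m → Z (p ^ r) m ≡ q ∸ h)
proposition7 p r k p-prime 2≤r _ q S≡r*q h 1≤h h<k (m , z≡q∸h) =
  [ (λ z+k≤q → <⇒≱ h<k (+-cancelˡ-≤ z k h (subst (z + k ≤_) (sym z+h≡q) z+k≤q)))
  , (λ q≤z → <⇒≱ (subst (z <_) z+h≡q (m<m+n z 1≤h)) q≤z)
  ]′ (Z[pʳ]-gap p-prime r k q m S≡r*q)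
  where
  instance
    r≢0 : NonZero r
    r≢0 = >-nonZero (≤-trans (s≤s z≤n) 2≤r)

  z : ℕ
  z = Z (p ^ r) m

  k≤q : k ≤ q
  k≤q = *-cancelʳ-≤ k q r (≤-trans (a≤repunit p {{prime⇒nonZero p-prime}} (k * r))
                                   (≤-reflexive (trans S≡r*q (*-comm r q))))

  z+h≡q : z + h ≡ q
  z+h≡q = trans (cong (_+ h) z≡q∸h) (m∸n+n≡m (<⇒≤ (<-≤-trans h<k k≤q)))
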